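{- For every $n\in\mathbb N$, $C_{L_n}\le C_{L_{n+1}}$.
   Context: For $n\in\mathbb N$, $L_n$ is the path graph with vertex set $\{1,\dots,n\}$ and edges $\{j,j+1\}$, with path distance $d(i,j)=|i-j|$. A measure $\mu$ on $L_n$ is a weight function $\mu:\{1,\dots,n\}\to(0,\infty)$, $\mu(A)=\sum_{v\in A}\mu(v)$. $B(x,r)=\{y:d(x,y)\le r\}$. $C_\mu=\sup\{\mu(B(x,2k+1))/\mu(B(x,k)): 1\le x\le n,\ k\in\{0,1,2,\dots\}\}$ and $C_{L_n}=\inf_\mu C_\mu$ over all measures on $L_n$.
   Formalization: The weights of the measures on $L_n$ and $L_{n+1}$ are positive rationals instead of arbitrary elements of $(0,\infty)$. -}

module Defs where

open import Data.Nat using (ℕ; suc; _+_; _*_; ∣_-_∣; _≤ᵇ_)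
open import Data.Fin using (Fin; toℕ)
open import Data.List using (List; map; foldr)
open import Data.List.Base using (allFin)
open import Data.Bool using (if_then_else_)
open import Data.Rational using (ℚ; 0ℚ) renaming (_+_ to _+ℚ_; _*_ to _*ℚ_; _≤_ to _≤ℚ_; _<_ to _<ℚ_)

-- Vertices of the path graph L_n are represented by Fin n (vertex i+1 ↦ i);
-- the path distance d(i,j) = |i - j| is unchanged by this shift.
dist : ∀ {n} → Fin n → Fin n → ℕ
dist i j = ∣ toℕ i - toℕ j ∣

IsMeasure : ∀ {n} → (Fin n → ℚ) → Set
IsMeasure μ = ∀ v → 0ℚ <ℚ μ v

sumℚ : List ℚ → ℚ
sumℚ = foldr _+ℚ_ 0ℚ

ballMeasure : ∀ {n} → (Fin n → ℚ) → Fin n → ℕ → ℚ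
ballMeasure {n} μ x r = sumℚ (map (λ v → if dist x v ≤ᵇ r then μ v else 0ℚ) (allFin n))

-- C_μ ≤ c, i.e. c bounds every ratio μ(B(x,2k+1)) / μ(B(x,k))
-- (stated multiplicatively; the denominators are positive).
DoublingBound : ∀ {n} → (Fin n → ℚ) → ℚ → Set
DoublingBound μ c = ∀ x k → ballMeasure μ x (suc (2 * k)) ≤ℚ c *ℚ ballMeasure μ x k

-- Let w be the weights of ν, extended by zero beyond the last vertex. If c > 3, take the uniform
-- measure on L_n: B(a, 2k+1) is B(a, k) plus a piece on either side, and each piece weighs
-- at most μ(B(a, k)). If c ≤ 3, doubling at radius 0 around the inner vertices makes w concave
-- on [0, n+1], and we delete the first vertex. Balls of the remaining measure that miss vertex 0
-- are balls of ν; the others are initial windows w 1 + ⋯ + w L, and their doubling follows from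
-- doubling of ν around vertex 0, subadditivity of w − w 0 (a consequence of concavity) and c ≥ 2.
{-# OPTIONS --safe #-}
module Submission where

open import Defs
open import Data.Nat using (ℕ; suc)
open import Data.Fin using (Fin)
open import Data.Product using (Σ; _×_)
open import Data.Rational using (ℚ; 0ℚ; _+_; _<_)

open import Data.Nat using (zero; z≤n; s≤s; ∣_-_∣; _≤ᵇ_)
import Data.Nat as ℕ
import Data.Nat.Properties as ℕ
open import Data.Fin using (toℕ)
import Data.Fin as Fin
import Data.Fin.Properties as Fin
open import Data.Rational using (1ℚ; _*_; _-_; -_; _≤_; _≤?_; positive; nonNegative)
open import Data.Rational.Properties
open import Data.Rational.Solver using (module +-*-Solver)
open import Data.Bool using (true; false; if_then_else_)
open import Data.List using (tabulate)
open import Data.List.Properties using (map-tabulate; tabulate-cong)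
open import Data.Product using (_,_)
open import Data.Sum using (inj₁; inj₂)
open import Function using (_∘_; id)
open import Relation.Binary.PropositionalEquality
open import Relation.Nullary using (yes; no; ofʸ; ofⁿ)

open +-*-Solver

2ℚ 3ℚ : ℚ
2ℚ = 1ℚ + 1ℚ
3ℚ = 2ℚ + 1ℚ

+-cancelʳ-≤ : ∀ r {p q} → p + r ≤ q + r → p ≤ q
+-cancelʳ-≤ r {p} {q} p+r≤q+r = subst₂ _≤_ (+r-r p) (+r-r q) (+-monoˡ-≤ (- r) p+r≤q+r)
  where
  +r-r : ∀ x → x + r + - r ≡ x
  +r-r x = solve 2 (λ x r → x :+ r :+ :- r := x) refl x r

-- A certificate for linear inequalities: add the hypotheses up to s ≤ t, then check p + t = q + s.
≤-by-balance : ∀ {p q s t} → s ≤ t → p + t ≡ q + s → p ≤ q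
≤-by-balance {p} {q} {s} s≤t eq = +-cancelʳ-≤ s (≤-trans (+-monoʳ-≤ p s≤t) (≤-reflexive eq))

*-monoˡ-≤-0≤ : ∀ {r p q} → 0ℚ ≤ r → p ≤ q → r * p ≤ r * q
*-monoˡ-≤-0≤ {r} 0≤r = *-monoˡ-≤-nonNeg r {{nonNegative 0≤r}}

*-monoʳ-≤-0≤ : ∀ {r p q} → 0ℚ ≤ r → p ≤ q → p * r ≤ q * r
*-monoʳ-≤-0≤ {r} 0≤r = *-monoʳ-≤-nonNeg r {{nonNegative 0≤r}}

p≤p+q : ∀ {p q} → 0ℚ ≤ q → p ≤ p + q
p≤p+q {p} {q} 0≤q = subst (_≤ p + q) (+-identityʳ p) (+-monoʳ-≤ p 0≤q)

p≤q+p : ∀ {p q} → 0ℚ ≤ q → p ≤ q + p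
p≤q+p {p} {q} 0≤q = subst (_≤ q + p) (+-identityˡ p) (+-monoˡ-≤ p 0≤q)

window : (ℕ → ℚ) → ℕ → ℕ → ℚ
window w p zero    = 0ℚ
window w p (suc L) = w p + window w (suc p) L

segment : (ℕ → ℚ) → ℕ → ℕ → ℚ
segment w lo hi = window w lo (hi ℕ.∸ lo)

-- With the weights extended by zero beyond the last vertex, B(a, r) is the window [a ∸ r, a + r].
ball : (ℕ → ℚ) → ℕ → ℕ → ℚ
ball w a r = segment w (a ℕ.∸ r) (suc (a ℕ.+ r))

module _ (w : ℕ → ℚ) where

  window-suc : ∀ p L → window w (suc p) L ≡ window (w ∘ suc) p L
  window-suc p zero    = refl
  window-suc p (suc L) = cong (w (suc p) +_) (window-suc (suc p) L)

  window-++ : ∀ p L M → window w p (L ℕ.+ M) ≡ window w p L + window w (p ℕ.+ L) M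
  window-++ p zero M = begin
    window w p M               ≡⟨ cong (λ q → window w q M) (ℕ.+-identityʳ p) ⟨
    window w (p ℕ.+ 0) M       ≡⟨ +-identityˡ _ ⟨
    0ℚ + window w (p ℕ.+ 0) M  ∎
    where open ≡-Reasoning
  window-++ p (suc L) M = begin
    w p + window w (suc p) (L ℕ.+ M)                        ≡⟨ cong (w p +_) (window-++ (suc p) L M) ⟩
    w p + (window w (suc p) L + window w (suc p ℕ.+ L) M)  ≡⟨ +-assoc (w p) _ _ ⟨
    window w p (suc L) + window w (suc p ℕ.+ L) M
      ≡⟨ cong (λ q → window w p (suc L) + window w q M) (ℕ.+-suc p L) ⟨
    window w p (suc L) + window w (p ℕ.+ suc L) M          ∎
    where open ≡-Reasoning

  window-snoc : ∀ p L → window w p (suc L) ≡ window w p L + w (p ℕ.+ L)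
  window-snoc p L = begin
    window w p (suc L)                         ≡⟨ cong (window w p) (ℕ.+-comm 1 L) ⟩
    window w p (L ℕ.+ 1)                       ≡⟨ window-++ p L 1 ⟩
    window w p L + (w (p ℕ.+ L) + 0ℚ)          ≡⟨ cong (window w p L +_) (+-identityʳ _) ⟩
    window w p L + w (p ℕ.+ L)                 ∎
    where open ≡-Reasoning

  segment-split : ∀ {lo mid hi} → lo ℕ.≤ mid → mid ℕ.≤ hi →
                  segment w lo hi ≡ segment w lo mid + segment w mid hi
  segment-split {lo} {mid} {hi} lo≤mid mid≤hi = begin
    window w lo (hi ℕ.∸ lo)                                          ≡⟨ cong (window w lo) length-split ⟩
    window w lo ((mid ℕ.∸ lo) ℕ.+ (hi ℕ.∸ mid))
      ≡⟨ window-++ lo (mid ℕ.∸ lo) (hi ℕ.∸ mid) ⟩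
    window w lo (mid ℕ.∸ lo) + window w (lo ℕ.+ (mid ℕ.∸ lo)) (hi ℕ.∸ mid)
      ≡⟨ cong (λ q → window w lo (mid ℕ.∸ lo) + window w q (hi ℕ.∸ mid)) (ℕ.m+[n∸m]≡n lo≤mid) ⟩
    window w lo (mid ℕ.∸ lo) + window w mid (hi ℕ.∸ mid)             ∎
    where
    open ≡-Reasoning
    length-split : hi ℕ.∸ lo ≡ (mid ℕ.∸ lo) ℕ.+ (hi ℕ.∸ mid)
    length-split = begin
      hi ℕ.∸ lo                                  ≡⟨ cong (ℕ._∸ lo) (ℕ.m+[n∸m]≡n mid≤hi) ⟨
      mid ℕ.+ (hi ℕ.∸ mid) ℕ.∸ lo                ≡⟨ ℕ.+-∸-comm (hi ℕ.∸ mid) lo≤mid ⟩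
      (mid ℕ.∸ lo) ℕ.+ (hi ℕ.∸ mid)              ∎

  module _ (w≥0 : ∀ i → 0ℚ ≤ w i) where

    window-nonneg : ∀ p L → 0ℚ ≤ window w p L
    window-nonneg p zero    = ≤-refl
    window-nonneg p (suc L) = +-mono-≤ (w≥0 p) (window-nonneg (suc p) L)

    window-mono-length : ∀ p {L M} → L ℕ.≤ M → window w p L ≤ window w p M
    window-mono-length p {zero}  {M}     _           = window-nonneg p M
    window-mono-length p {suc L} {suc M} (s≤s L≤M)  = +-monoʳ-≤ (w p) (window-mono-length (suc p) L≤M)

window-≤ : ∀ {v w : ℕ → ℚ} p q L → (∀ j → j ℕ.< L → v (p ℕ.+ j) ≤ w (q ℕ.+ j)) →
           window v p L ≤ window w q L
window-≤ p q zero    _ = ≤-refl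
window-≤ {v} {w} p q (suc L) v≤w = +-mono-≤ head (window-≤ (suc p) (suc q) L tail)
  where
  head : v p ≤ w q
  head = subst₂ (λ i j → v i ≤ w j) (ℕ.+-identityʳ p) (ℕ.+-identityʳ q) (v≤w 0 (s≤s z≤n))
  tail : ∀ j → j ℕ.< L → v (suc p ℕ.+ j) ≤ w (suc q ℕ.+ j)
  tail j j<L = subst₂ (λ i k → v i ≤ w k) (ℕ.+-suc p j) (ℕ.+-suc q j) (v≤w (suc j) (s≤s j<L))

segment-mono-lo : ∀ w → (∀ i → 0ℚ ≤ w i) → ∀ {lo mid hi} → lo ℕ.≤ mid → mid ℕ.≤ hi →
                  segment w mid hi ≤ segment w lo hi
segment-mono-lo w w≥0 {lo} {mid} lo≤mid mid≤hi =
  subst (segment w mid _ ≤_) (sym (segment-split w lo≤mid mid≤hi))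
    (p≤q+p (window-nonneg w w≥0 lo (mid ℕ.∸ lo)))

segment-mono-hi : ∀ w → (∀ i → 0ℚ ≤ w i) → ∀ lo {mid hi} → mid ℕ.≤ hi →
                  segment w lo mid ≤ segment w lo hi
segment-mono-hi w w≥0 lo mid≤hi = window-mono-length w w≥0 lo (ℕ.∸-monoˡ-≤ lo mid≤hi)

ball-centre0 : ∀ w r → ball w 0 r ≡ window w 0 (suc r)
ball-centre0 w r = cong (λ lo → segment w lo (suc r)) (ℕ.0∸n≡0 r)

ball-left : ∀ w {a r} → a ℕ.≤ r → ball w a r ≡ window w 0 (suc (a ℕ.+ r))
ball-left w {a} {r} a≤r = cong (λ lo → segment w lo (suc (a ℕ.+ r))) (ℕ.m≤n⇒m∸n≡0 a≤r)

ball-inner : ∀ w {a r} → r ℕ.≤ a → ball w a r ≡ window w (a ℕ.∸ r) (suc (r ℕ.+ r))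
ball-inner w {a} {r} r≤a = cong (window w lo) (begin
  suc (a ℕ.+ r) ℕ.∸ lo                ≡⟨ cong (λ x → suc (x ℕ.+ r) ℕ.∸ lo) (ℕ.m∸n+n≡m r≤a) ⟨
  suc (lo ℕ.+ r ℕ.+ r) ℕ.∸ lo         ≡⟨ cong (λ x → suc x ℕ.∸ lo) (ℕ.+-assoc lo r r) ⟩
  suc (lo ℕ.+ (r ℕ.+ r)) ℕ.∸ lo       ≡⟨ cong (ℕ._∸ lo) (ℕ.+-suc lo (r ℕ.+ r)) ⟨
  lo ℕ.+ suc (r ℕ.+ r) ℕ.∸ lo         ≡⟨ ℕ.m+n∸m≡n lo (suc (r ℕ.+ r)) ⟩
  suc (r ℕ.+ r)                       ∎)
  where
  open ≡-Reasoning
  lo : ℕ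
  lo = a ℕ.∸ r

ball-suc-inner : ∀ w {a r} → r ℕ.≤ a → ball w (suc a) r ≡ ball (w ∘ suc) a r
ball-suc-inner w {a} {r} r≤a = begin
  segment w (suc a ℕ.∸ r) (suc (suc a ℕ.+ r))
    ≡⟨ cong (λ lo → segment w lo (suc (suc a ℕ.+ r))) (ℕ.+-∸-assoc 1 r≤a) ⟩
  window w (suc (a ℕ.∸ r)) (suc (a ℕ.+ r) ℕ.∸ (a ℕ.∸ r))
    ≡⟨ window-suc w (a ℕ.∸ r) (suc (a ℕ.+ r) ℕ.∸ (a ℕ.∸ r)) ⟩
  ball (w ∘ suc) a r                                        ∎
  where open ≡-Reasoning

ball-suc-left : ∀ w {a r} → a ℕ.< r → ball w (suc a) r ≡ w 0 + ball (w ∘ suc) a r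
ball-suc-left w {a} {r} a<r = begin
  ball w (suc a) r                          ≡⟨ ball-left w a<r ⟩
  w 0 + window w 1 (suc (a ℕ.+ r))          ≡⟨ cong (w 0 +_) (window-suc w 0 (suc (a ℕ.+ r))) ⟩
  w 0 + window (w ∘ suc) 0 (suc (a ℕ.+ r))  ≡⟨ cong (w 0 +_) (ball-left (w ∘ suc) (ℕ.<⇒≤ a<r)) ⟨
  w 0 + ball (w ∘ suc) a r                  ∎
  where open ≡-Reasoning

ball-tail-left : ∀ w {a r} → a ℕ.≤ r → ball (w ∘ suc) a r ≡ window w 1 (suc (a ℕ.+ r))
ball-tail-left w {a} {r} a≤r = trans (ball-left (w ∘ suc) a≤r) (sym (window-suc w 0 (suc (a ℕ.+ r))))

ball-tail≤ball-suc : ∀ w → 0ℚ ≤ w 0 → ∀ a r → ball (w ∘ suc) a r ≤ ball w (suc a) r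
ball-tail≤ball-suc w w₀≥0 a r with r ℕ.≤? a
... | yes r≤a = ≤-reflexive (sym (ball-suc-inner w r≤a))
... | no  r≰a = subst (ball (w ∘ suc) a r ≤_) (sym (ball-suc-left w (ℕ.≰⇒> r≰a))) (p≤q+p w₀≥0)

extend : ∀ {n} → (Fin n → ℚ) → ℕ → ℚ
extend {zero}  ρ i       = 0ℚ
extend {suc n} ρ zero    = ρ Fin.zero
extend {suc n} ρ (suc i) = extend (ρ ∘ Fin.suc) i

extend-nonneg : ∀ {n} {ρ : Fin n → ℚ} → IsMeasure ρ → ∀ i → 0ℚ ≤ extend ρ i
extend-nonneg {zero}  ρ>0 i       = ≤-refl
extend-nonneg {suc n} ρ>0 zero    = <⇒≤ (ρ>0 Fin.zero)
extend-nonneg {suc n} ρ>0 (suc i) = extend-nonneg (ρ>0 ∘ Fin.suc) i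

extend-pos : ∀ {n} {ρ : Fin n → ℚ} → IsMeasure ρ → ∀ {i} → i ℕ.< n → 0ℚ < extend ρ i
extend-pos {suc n} ρ>0 {zero}  _         = ρ>0 Fin.zero
extend-pos {suc n} ρ>0 {suc i} (s≤s i<n) = extend-pos (ρ>0 ∘ Fin.suc) i<n

extend-vanishes : ∀ {n} (ρ : Fin n → ℚ) {i} → n ℕ.≤ i → extend ρ i ≡ 0ℚ
extend-vanishes {zero}  ρ         _         = refl
extend-vanishes {suc n} ρ {suc i} (s≤s n≤i) = extend-vanishes (ρ ∘ Fin.suc) n≤i

extend-const : ∀ {n} x {i} → i ℕ.< n → extend {n} (λ _ → x) i ≡ x
extend-const {suc n} x {zero}  _         = refl
extend-const {suc n} x {suc i} (s≤s i<n) = extend-const x i<n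

-- The centre ranges over ℕ so that the recursion on n can shift it.
ballMeasureℕ : ∀ {n} → (Fin n → ℚ) → ℕ → ℕ → ℚ
ballMeasureℕ ρ a r = sumℚ (tabulate (λ v → if ∣ a - toℕ v ∣ ≤ᵇ r then ρ v else 0ℚ))

sumℚ-zeros : ∀ n → sumℚ (tabulate {n = n} (λ _ → 0ℚ)) ≡ 0ℚ
sumℚ-zeros zero    = refl
sumℚ-zeros (suc n) = trans (+-identityˡ _) (sumℚ-zeros n)

window-zeros : ∀ p L → window (λ _ → 0ℚ) p L ≡ 0ℚ
window-zeros p zero    = refl
window-zeros p (suc L) = trans (+-identityˡ _) (window-zeros (suc p) L)

suc≤ᵇsuc : ∀ m n → (suc m ≤ᵇ suc n) ≡ (m ≤ᵇ n)
suc≤ᵇsuc zero    n = refl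
suc≤ᵇsuc (suc m) n = refl

ballMeasureℕ≡ball : ∀ {n} (ρ : Fin n → ℚ) a r → ballMeasureℕ ρ a r ≡ ball (extend ρ) a r
ballMeasureℕ≡ball {zero}  ρ a       r       =
  sym (window-zeros (a ℕ.∸ r) (suc (a ℕ.+ r) ℕ.∸ (a ℕ.∸ r)))
ballMeasureℕ≡ball {suc n} ρ zero    zero    = cong (ρ Fin.zero +_) (sumℚ-zeros n)
ballMeasureℕ≡ball {suc n} ρ zero    (suc r) = cong (ρ Fin.zero +_) (begin
  sumℚ (tabulate (λ v → if suc (toℕ v) ≤ᵇ suc r then ρ (Fin.suc v) else 0ℚ))
    ≡⟨ cong sumℚ (tabulate-cong (λ v → cong (if_then ρ (Fin.suc v) else 0ℚ) (suc≤ᵇsuc (toℕ v) r))) ⟩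
  ballMeasureℕ (ρ ∘ Fin.suc) 0 r            ≡⟨ ballMeasureℕ≡ball (ρ ∘ Fin.suc) 0 r ⟩
  ball (extend (ρ ∘ Fin.suc)) 0 r           ≡⟨ ball-centre0 _ r ⟩
  window (extend ρ ∘ suc) 0 (suc r)         ≡⟨ window-suc (extend ρ) 0 (suc r) ⟨
  window (extend ρ) 1 (suc r)               ∎)
  where open ≡-Reasoning
ballMeasureℕ≡ball {suc n} ρ (suc a) r with suc a ≤ᵇ r | ℕ.≤ᵇ-reflects-≤ (suc a) r
... | true  | ofʸ a<r = trans (cong (ρ Fin.zero +_) (ballMeasureℕ≡ball (ρ ∘ Fin.suc) a r))
                              (sym (ball-suc-left (extend ρ) a<r))
... | false | ofⁿ a≮r = trans (+-identityˡ _) (trans (ballMeasureℕ≡ball (ρ ∘ Fin.suc) a r)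
                              (sym (ball-suc-inner (extend ρ) (ℕ.≮⇒≥ a≮r))))

ballMeasure≡ball : ∀ {n} (ρ : Fin n → ℚ) x r → ballMeasure ρ x r ≡ ball (extend ρ) (toℕ x) r
ballMeasure≡ball ρ x r =
  trans (cong sumℚ (map-tabulate id (λ v → if dist x v ≤ᵇ r then ρ v else 0ℚ))) (ballMeasureℕ≡ball ρ (toℕ x) r)

BallDoubling : ℕ → (ℕ → ℚ) → ℚ → Set
BallDoubling n w c = ∀ a → a ℕ.< n → ∀ k → ball w a (suc (k ℕ.+ k)) ≤ c * ball w a k

ballMeasure-doubled : ∀ {n} (ρ : Fin n → ℚ) x k →
                      ballMeasure ρ x (suc (2 ℕ.* k)) ≡ ball (extend ρ) (toℕ x) (suc (k ℕ.+ k))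
ballMeasure-doubled ρ x k = trans (ballMeasure≡ball ρ x _)
  (cong (λ m → ball (extend ρ) (toℕ x) (suc (k ℕ.+ m))) (ℕ.+-identityʳ k))

toBallDoubling : ∀ {n} (ρ : Fin n → ℚ) c → DoublingBound ρ c → BallDoubling n (extend ρ) c
toBallDoubling {n} ρ c ρ-doubling a a<n k =
  subst (λ a → ball (extend ρ) a (suc (k ℕ.+ k)) ≤ c * ball (extend ρ) a k) (Fin.toℕ-fromℕ< a<n)
    (subst₂ (λ p q → p ≤ c * q) (ballMeasure-doubled ρ x k) (ballMeasure≡ball ρ x k) (ρ-doubling x k))
  where
  x : Fin n
  x = Fin.fromℕ< a<n

fromBallDoubling : ∀ {n} (ρ : Fin n → ℚ) c → BallDoubling n (extend ρ) c → DoublingBound ρ c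
fromBallDoubling ρ c ρ-doubling x k =
  subst₂ (λ p q → p ≤ c * q) (sym (ballMeasure-doubled ρ x k)) (sym (ballMeasure≡ball ρ x k))
    (ρ-doubling (toℕ x) (Fin.toℕ<n x) k)

ballDoubling-mono : ∀ {n w c d} → (∀ i → 0ℚ ≤ w i) → c ≤ d → BallDoubling n w c → BallDoubling n w d
ballDoubling-mono {w = w} w≥0 c≤d w-doubling a a<n k =
  ≤-trans (w-doubling a a<n k)
    (*-monoʳ-≤-0≤ (window-nonneg w w≥0 (a ℕ.∸ k) (suc (a ℕ.+ k) ℕ.∸ (a ℕ.∸ k))) c≤d)

m∸[m∸n]≤n : ∀ m n → m ℕ.∸ (m ℕ.∸ n) ℕ.≤ n
m∸[m∸n]≤n m n with n ℕ.≤? m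
... | yes n≤m = ℕ.≤-reflexive (ℕ.m∸[m∸n]≡n n≤m)
... | no  n≰m = subst (λ x → m ℕ.∸ x ℕ.≤ n) (sym (ℕ.m≤n⇒m∸n≡0 m≤n)) m≤n
  where
  m≤n : m ℕ.≤ n
  m≤n = ℕ.<⇒≤ (ℕ.≰⇒> n≰m)

-- The left excess [a ∸ (2k+1), a ∸ k) of B(a, 2k+1) over B(a, k) is no longer than [a ∸ k, a].
left-excess-fits : ∀ a k → (a ℕ.∸ k) ℕ.+ ((a ℕ.∸ k) ℕ.∸ (a ℕ.∸ suc (k ℕ.+ k))) ℕ.≤ suc a
left-excess-fits a k with k ℕ.≤? a
... | no  k≰a rewrite ℕ.m≤n⇒m∸n≡0 (ℕ.<⇒≤ (ℕ.≰⇒> k≰a)) | ℕ.0∸n≡0 (a ℕ.∸ suc (k ℕ.+ k)) = z≤n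
... | yes k≤a = begin
  lo ℕ.+ (lo ℕ.∸ (a ℕ.∸ suc (k ℕ.+ k)))   ≡⟨ cong (λ x → lo ℕ.+ (lo ℕ.∸ x)) lo′≡ ⟩
  lo ℕ.+ (lo ℕ.∸ (lo ℕ.∸ suc k))          ≤⟨ ℕ.+-monoʳ-≤ lo (m∸[m∸n]≤n lo (suc k)) ⟩
  lo ℕ.+ suc k                            ≡⟨ ℕ.+-suc lo k ⟩
  suc (lo ℕ.+ k)                          ≡⟨ cong suc (ℕ.m∸n+n≡m k≤a) ⟩
  suc a                                   ∎
  where
  open ℕ.≤-Reasoning
  lo : ℕ
  lo = a ℕ.∸ k
  lo′≡ : a ℕ.∸ suc (k ℕ.+ k) ≡ lo ℕ.∸ suc k
  lo′≡ = trans (cong (a ℕ.∸_) (sym (ℕ.+-suc k k))) (sym (ℕ.∸-+-assoc a k (suc k)))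

ball-doubled-split : ∀ w a k →
  ball w a (suc (k ℕ.+ k)) ≡ segment w (a ℕ.∸ suc (k ℕ.+ k)) (a ℕ.∸ k)
                             + (ball w a k + segment w (suc (a ℕ.+ k)) (suc (a ℕ.+ suc (k ℕ.+ k))))
ball-doubled-split w a k =
  trans (segment-split w lo′≤lo (ℕ.≤-trans lo≤hi hi≤hi′))
        (cong (segment w (a ℕ.∸ suc (k ℕ.+ k)) (a ℕ.∸ k) +_) (segment-split w lo≤hi hi≤hi′))
  where
  k≤2k+1 : k ℕ.≤ suc (k ℕ.+ k)
  k≤2k+1 = ℕ.m≤n⇒m≤1+n (ℕ.m≤m+n k k)
  lo′≤lo : a ℕ.∸ suc (k ℕ.+ k) ℕ.≤ a ℕ.∸ k
  lo′≤lo = ℕ.∸-monoʳ-≤ a k≤2k+1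
  lo≤hi : a ℕ.∸ k ℕ.≤ suc (a ℕ.+ k)
  lo≤hi = ℕ.≤-trans (ℕ.m∸n≤m a k) (ℕ.m≤n⇒m≤1+n (ℕ.m≤m+n a k))
  hi≤hi′ : suc (a ℕ.+ k) ℕ.≤ suc (a ℕ.+ suc (k ℕ.+ k))
  hi≤hi′ = s≤s (ℕ.+-monoʳ-≤ a k≤2k+1)

right-excess≤ball : ∀ w → (∀ i → 0ℚ ≤ w i) → (∀ {i j} → i ℕ.≤ j → w j ≤ w i) → ∀ a k →
                    segment w (suc (a ℕ.+ k)) (suc (a ℕ.+ suc (k ℕ.+ k))) ≤ ball w a k
right-excess≤ball w w≥0 antitone a k = begin
  window w hi (hi′ ℕ.∸ hi)  ≡⟨ cong (window w hi) hi′∸hi ⟩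
  window w hi (suc k)       ≤⟨ window-≤ {w} {w} hi a (suc k) (λ j _ → antitone (ℕ.+-monoˡ-≤ j a≤hi)) ⟩
  window w a (suc k)        ≡⟨ cong (window w a) hi∸a ⟨
  segment w a hi            ≤⟨ segment-mono-lo w w≥0 (ℕ.m∸n≤m a k) a≤hi ⟩
  ball w a k                ∎
  where
  open ≤-Reasoning
  hi hi′ : ℕ
  hi  = suc (a ℕ.+ k)
  hi′ = suc (a ℕ.+ suc (k ℕ.+ k))
  a≤hi : a ℕ.≤ hi
  a≤hi = ℕ.m≤n⇒m≤1+n (ℕ.m≤m+n a k)
  hi∸a : hi ℕ.∸ a ≡ suc k
  hi∸a = trans (cong (ℕ._∸ a) (sym (ℕ.+-suc a k))) (ℕ.m+n∸m≡n a (suc k))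
  hi′∸hi : hi′ ℕ.∸ hi ≡ suc k
  hi′∸hi = trans (ℕ.[m+n]∸[m+o]≡n∸o a (suc (k ℕ.+ k)) k)
             (trans (ℕ.+-∸-assoc 1 (ℕ.m≤m+n k k)) (cong suc (ℕ.m+n∸m≡n k k)))

left-excess≤ball : ∀ w n → (∀ i → 0ℚ ≤ w i) → (∀ {i} j → i ℕ.< n → w j ≤ w i) →
                   ∀ {a} k → a ℕ.< n →
                   segment w (a ℕ.∸ suc (k ℕ.+ k)) (a ℕ.∸ k) ≤ ball w a k
left-excess≤ball w n w≥0 maximal {a} k a<n = begin
  window w lo′ ℓ            ≤⟨ window-≤ {w} {w} lo′ lo ℓ (λ j j<ℓ → maximal (lo′ ℕ.+ j)
                                 (ℕ.<-≤-trans (ℕ.+-monoʳ-< lo j<ℓ) (ℕ.≤-trans fits a<n))) ⟩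
  window w lo ℓ             ≡⟨ cong (window w lo) (ℕ.m+n∸m≡n lo ℓ) ⟨
  segment w lo (lo ℕ.+ ℓ)   ≤⟨ segment-mono-hi w w≥0 lo (ℕ.≤-trans fits (s≤s (ℕ.m≤m+n a k))) ⟩
  ball w a k                ∎
  where
  open ≤-Reasoning
  lo lo′ ℓ : ℕ
  lo  = a ℕ.∸ k
  lo′ = a ℕ.∸ suc (k ℕ.+ k)
  ℓ   = lo ℕ.∸ lo′
  fits : lo ℕ.+ ℓ ℕ.≤ suc a
  fits = left-excess-fits a k

uniform : ∀ n → Fin n → ℚ
uniform n _ = 1ℚ

uniform-isMeasure : ∀ n → IsMeasure (uniform n)
uniform-isMeasure n _ = positive⁻¹ 1ℚ

module _ (n : ℕ) where

  private
    u : ℕ → ℚ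
    u = extend (uniform n)

    u≥0 : ∀ i → 0ℚ ≤ u i
    u≥0 = extend-nonneg (uniform-isMeasure n)

  uniform-≤1 : ∀ j → u j ≤ 1ℚ
  uniform-≤1 j with j ℕ.<? n
  ... | yes j<n = ≤-reflexive (extend-const 1ℚ j<n)
  ... | no  j≮n = subst (_≤ 1ℚ) (sym (extend-vanishes (uniform n) (ℕ.≮⇒≥ j≮n)))
                    (<⇒≤ (positive⁻¹ 1ℚ))

  uniform-maximal : ∀ {i} j → i ℕ.< n → u j ≤ u i
  uniform-maximal j i<n = subst (u j ≤_) (sym (extend-const 1ℚ i<n)) (uniform-≤1 j)

  uniform-antitone : ∀ {i j} → i ℕ.≤ j → u j ≤ u i
  uniform-antitone {i} {j} i≤j with j ℕ.<? n
  ... | yes j<n = uniform-maximal j (ℕ.≤-<-trans i≤j j<n)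
  ... | no  j≮n = subst (_≤ u i) (sym (extend-vanishes (uniform n) (ℕ.≮⇒≥ j≮n))) (u≥0 i)

  uniform-doubling : BallDoubling n u 3ℚ
  uniform-doubling a a<n k = begin
    ball u a (suc (k ℕ.+ k))   ≡⟨ ball-doubled-split u a k ⟩
    L + (D + R)                ≤⟨ +-mono-≤ (left-excess≤ball u n u≥0 uniform-maximal k a<n)
                                           (+-monoʳ-≤ D (right-excess≤ball u u≥0 uniform-antitone a k)) ⟩
    D + (D + D)                ≡⟨ solve 1 (λ d → d :+ (d :+ d) := con 3ℚ :* d) refl D ⟩
    3ℚ * D                     ∎
    where
    open ≤-Reasoning
    L D R : ℚ
    L = segment u (a ℕ.∸ suc (k ℕ.+ k)) (a ℕ.∸ k)
    D = ball u a k
    R = segment u (suc (a ℕ.+ k)) (suc (a ℕ.+ suc (k ℕ.+ k)))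

Concave : ℕ → (ℕ → ℚ) → Set
Concave N w = ∀ y → 2 ℕ.+ y ℕ.≤ N → w y + w (2 ℕ.+ y) ≤ w (suc y) + w (suc y)

-- Doubling at radius 0 around an inner vertex y+1 gives w y + w (y+1) + w (y+2) ≤ c · w (y+1).
doubling⇒concave : ∀ {N w c} → (∀ i → 0ℚ ≤ w i) → c ≤ 3ℚ → BallDoubling N w c → Concave N w
doubling⇒concave {w = w} {c} w≥0 c≤3 w-doubling y 2+y≤N = ≤-by-balance local-bound balance
  where
  w₁ : ℚ
  w₁ = w (suc y)
  local-bound : w y + (w₁ + (w (2 ℕ.+ y) + 0ℚ)) ≤ 3ℚ * (w₁ + 0ℚ)
  local-bound = ≤-trans
    (subst₂ (λ p q → p ≤ c * q) (ball-inner w (s≤s z≤n)) (ball-inner w z≤n) (w-doubling (suc y) 2+y≤N 0))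
    (*-monoʳ-≤-0≤ (+-mono-≤ (w≥0 (suc y)) ≤-refl) c≤3)
  balance : w y + w (2 ℕ.+ y) + 3ℚ * (w₁ + 0ℚ) ≡ w₁ + w₁ + (w y + (w₁ + (w (2 ℕ.+ y) + 0ℚ)))
  balance = solve 3 (λ a b d → a :+ d :+ con 3ℚ :* (b :+ con 0ℚ) := b :+ b :+ (a :+ (b :+ (d :+ con 0ℚ))))
                  refl (w y) w₁ (w (2 ℕ.+ y))

module _ {N} {w : ℕ → ℚ} (concave : Concave N w) where

  concave-increments : ∀ a d → suc (d ℕ.+ a) ℕ.≤ N → w (suc (d ℕ.+ a)) + w a ≤ w (d ℕ.+ a) + w (suc a)
  concave-increments a zero    _  = ≤-reflexive (+-comm (w (suc a)) (w a))
  concave-increments a (suc d) le = ≤-by-balance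
    (+-mono-≤ (concave-increments a d (ℕ.≤-trans (ℕ.n≤1+n _) le)) (concave (d ℕ.+ a) le))
    (solve 5 (λ wa wa′ wi wi′ wi″ → wi″ :+ wa :+ (wi :+ wa′ :+ (wi′ :+ wi′))
                                   := wi′ :+ wa′ :+ (wi′ :+ wa :+ (wi :+ wi″)))
           refl (w a) (w (suc a)) (w (d ℕ.+ a)) (w (suc (d ℕ.+ a))) (w (2 ℕ.+ (d ℕ.+ a))))

  concave-subadditive : ∀ j m → m ℕ.+ j ℕ.≤ N → w (m ℕ.+ j) + w 0 ≤ w j + w m
  concave-subadditive j zero    _  = ≤-refl
  concave-subadditive j (suc m) le = ≤-by-balance
    (+-mono-≤ (concave-subadditive j m (ℕ.≤-trans (ℕ.n≤1+n _) le)) increment)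
    (solve 6 (λ w₀ wj wm wm′ wi wi′ → wi′ :+ w₀ :+ (wj :+ wm :+ (wi :+ wm′))
                                    := wj :+ wm′ :+ (wi :+ w₀ :+ (wi′ :+ wm)))
           refl (w 0) (w j) (w m) (w (suc m)) (w (m ℕ.+ j)) (w (suc (m ℕ.+ j))))
    where
    increment : w (suc (m ℕ.+ j)) + w m ≤ w (m ℕ.+ j) + w (suc m)
    increment = subst (λ i → w (suc i) + w m ≤ w i + w (suc m)) (ℕ.+-comm j m)
                      (concave-increments m j (subst (λ i → suc i ℕ.≤ N) (ℕ.+-comm m j) le))

-- The lighter of the first two vertices x has μ(B(x, 1)) ≥ 2 μ(x).
doubling⇒2≤c : ∀ {N w c} → (∀ i → 0ℚ ≤ w i) → 0ℚ < w 0 → 0ℚ < w 1 → 2 ℕ.≤ N →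
               BallDoubling N w c → 2ℚ ≤ c
doubling⇒2≤c {w = w} {c} w≥0 w₀>0 w₁>0 2≤N w-doubling with ≤-total (w 0) (w 1)
... | inj₁ w₀≤w₁ = *-cancelʳ-≤-pos (w 0) {{positive w₀>0}} (begin
  2ℚ * w 0            ≡⟨ solve 1 (λ x → con 2ℚ :* x := x :+ (x :+ con 0ℚ)) refl (w 0) ⟩
  w 0 + (w 0 + 0ℚ)    ≤⟨ +-monoʳ-≤ (w 0) (+-monoˡ-≤ 0ℚ w₀≤w₁) ⟩
  ball w 0 1          ≤⟨ w-doubling 0 (ℕ.≤-trans (s≤s z≤n) 2≤N) 0 ⟩
  c * (w 0 + 0ℚ)      ≡⟨ cong (c *_) (+-identityʳ (w 0)) ⟩
  c * w 0             ∎)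
  where open ≤-Reasoning
... | inj₂ w₁≤w₀ = *-cancelʳ-≤-pos (w 1) {{positive w₁>0}} (begin
  2ℚ * w 1                      ≡⟨ solve 1 (λ x → con 2ℚ :* x := x :+ x) refl (w 1) ⟩
  w 1 + w 1                     ≤⟨ +-mono-≤ w₁≤w₀ (p≤p+q (+-mono-≤ (w≥0 2) ≤-refl)) ⟩
  ball w 1 1                    ≤⟨ w-doubling 1 2≤N 0 ⟩
  c * (w 1 + 0ℚ)                ≡⟨ cong (c *_) (+-identityʳ (w 1)) ⟩
  c * w 1                       ∎)
  where open ≤-Reasoning

module _ {N} {w : ℕ → ℚ} {c}
         (w≥0 : ∀ i → 0ℚ ≤ w i) (w-vanishes : ∀ {i} → N ℕ.≤ i → w i ≡ 0ℚ)
         (concave : Concave N w) (0<N : 0 ℕ.< N) (w-doubling : BallDoubling N w c) (2≤c : 2ℚ ≤ c)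
  where

  second-half≤first-half : ∀ m → w (suc m) ≤ w 0 → window w (2 ℕ.+ m) (suc m) ≤ window w 1 (suc m)
  second-half≤first-half m wM≤w₀ = window-≤ {w} {w} (2 ℕ.+ m) 1 (suc m) pointwise
    where
    M : ℕ
    M = suc m
    pointwise : ∀ j → j ℕ.< M → w (suc M ℕ.+ j) ≤ w (suc j)
    pointwise j _ with M ℕ.+ suc j ℕ.≤? N
    ... | yes fits = +-cancelʳ-≤ (w 0) (begin
          w (suc M ℕ.+ j) + w 0   ≡⟨ cong (λ i → w i + w 0) (ℕ.+-suc M j) ⟨
          w (M ℕ.+ suc j) + w 0   ≤⟨ concave-subadditive {w = w} concave (suc j) M fits ⟩
          w (suc j) + w M         ≤⟨ +-monoʳ-≤ (w (suc j)) wM≤w₀ ⟩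
          w (suc j) + w 0         ∎)
      where open ≤-Reasoning
    ... | no  ¬fits = subst (_≤ w (suc j)) (sym (w-vanishes beyond)) (w≥0 (suc j))
      where
      beyond : N ℕ.≤ suc M ℕ.+ j
      beyond = subst (N ℕ.≤_) (ℕ.+-suc M j) (ℕ.<⇒≤ (ℕ.≰⇒> ¬fits))

  doubled-index≤ : ∀ m → w 0 ≤ w (suc m) → w (suc (suc (m ℕ.+ m))) + w 0 ≤ w (suc m) + w (suc m)
  doubled-index≤ m w₀≤wM with suc m ℕ.+ suc m ℕ.≤? N
  ... | yes fits = subst (λ i → w i + w 0 ≤ w (suc m) + w (suc m)) (cong suc (ℕ.+-suc m m))
                     (concave-subadditive {w = w} concave (suc m) (suc m) fits)
  ... | no  ¬fits = subst (λ x → x + w 0 ≤ w (suc m) + w (suc m)) (sym (w-vanishes beyond))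
                      (+-mono-≤ (w≥0 (suc m)) w₀≤wM)
    where
    beyond : N ℕ.≤ suc (suc (m ℕ.+ m))
    beyond = subst (N ℕ.≤_) (cong suc (ℕ.+-suc m m)) (ℕ.<⇒≤ (ℕ.≰⇒> ¬fits))

  -- If w (m+1) ≤ w 0, the second half of the window is no heavier than the first and c ≥ 2.
  -- Otherwise, shifting the doubling around vertex 0 by one index costs w (2m+2) − w 0 on the
  -- left and gains c (w (m+1) − w 0) on the right, and concavity bounds the cost by 2 (w (m+1) − w 0).
  initial-window-doubling : ∀ m → window w 1 (suc m ℕ.+ suc m) ≤ c * window w 1 (suc m)
  initial-window-doubling m with ≤-total (w (suc m)) (w 0)
  ... | inj₁ wM≤w₀ = begin
    window w 1 (M ℕ.+ M)            ≡⟨ window-++ w 1 M M ⟩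
    Y + window w (suc M) M          ≤⟨ +-monoʳ-≤ Y (second-half≤first-half m wM≤w₀) ⟩
    Y + Y                           ≡⟨ solve 1 (λ y → y :+ y := con 2ℚ :* y) refl Y ⟩
    2ℚ * Y                          ≤⟨ *-monoʳ-≤-0≤ (window-nonneg w w≥0 1 M) 2≤c ⟩
    c * Y                           ∎
    where
    open ≤-Reasoning
    M : ℕ
    M = suc m
    Y : ℚ
    Y = window w 1 M
  ... | inj₂ w₀≤wM = subst₂ (λ p q → p ≤ c * q) (sym total) (sym half)
                       (≤-by-balance (+-mono-≤ (+-mono-≤ centred (doubled-index≤ m w₀≤wM)) slack) balance)
    where
    M T : ℕ
    M = suc m
    T = suc (suc (m ℕ.+ m))
    X A : ℚ
    X = window w 1 (suc (m ℕ.+ m))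
    A = window w 1 m
    total : window w 1 (M ℕ.+ M) ≡ X + w T
    total = trans (cong (λ L → window w 1 (suc L)) (ℕ.+-suc m m)) (window-snoc w 1 (suc (m ℕ.+ m)))
    half : window w 1 M ≡ A + w M
    half = window-snoc w 1 m
    centred : w 0 + X ≤ c * (w 0 + A)
    centred = subst (λ q → w 0 + X ≤ c * q) (ball-centre0 w m) (w-doubling 0 0<N m)
    slack : (c - 2ℚ) * w 0 ≤ (c - 2ℚ) * w M
    slack = *-monoˡ-≤-0≤ (subst (_≤ c - 2ℚ) (+-inverseʳ 2ℚ) (+-monoˡ-≤ (- 2ℚ) 2≤c)) w₀≤wM
    balance : X + w T + (c * (w 0 + A) + (w M + w M) + (c - 2ℚ) * w M)
            ≡ c * (A + w M) + (w 0 + X + (w T + w 0) + (c - 2ℚ) * w 0)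
    balance = solve 6 (λ w₀ x a wT wM c → x :+ wT :+ (c :* (w₀ :+ a) :+ (wM :+ wM) :+ (c :- con 2ℚ) :* wM)
                                        := c :* (a :+ wM) :+ (w₀ :+ x :+ (wT :+ w₀) :+ (c :- con 2ℚ) :* w₀))
                      refl (w 0) X A (w T) (w M) c

a+2k+2≤2[a+k+1] : ∀ a k → suc (a ℕ.+ suc (k ℕ.+ k)) ℕ.≤ suc (a ℕ.+ k) ℕ.+ suc (a ℕ.+ k)
a+2k+2≤2[a+k+1] a k = s≤s (begin
  a ℕ.+ suc (k ℕ.+ k)        ≡⟨ cong (a ℕ.+_) (ℕ.+-suc k k) ⟨
  a ℕ.+ (k ℕ.+ suc k)        ≡⟨ ℕ.+-assoc a k (suc k) ⟨
  a ℕ.+ k ℕ.+ suc k          ≤⟨ ℕ.+-monoʳ-≤ (a ℕ.+ k) (s≤s (ℕ.m≤n+m k a)) ⟩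
  a ℕ.+ k ℕ.+ suc (a ℕ.+ k)  ∎)
  where open ℕ.≤-Reasoning

module _ {n} {ν : Fin (suc n) → ℚ} {c} (ν>0 : IsMeasure ν) (c≤3 : c ≤ 3ℚ)
         (ν-doubling : BallDoubling (suc n) (extend ν) c) where

  private
    w : ℕ → ℚ
    w = extend ν

    w≥0 : ∀ i → 0ℚ ≤ w i
    w≥0 = extend-nonneg ν>0

  tail-doubling : BallDoubling n (extend (ν ∘ Fin.suc)) c
  tail-doubling a a<n k with k ℕ.≤? a
  ... | yes k≤a = begin
    ball (w ∘ suc) a (suc (k ℕ.+ k))   ≤⟨ ball-tail≤ball-suc w (w≥0 0) a (suc (k ℕ.+ k)) ⟩
    ball w (suc a) (suc (k ℕ.+ k))     ≤⟨ ν-doubling (suc a) (s≤s a<n) k ⟩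
    c * ball w (suc a) k               ≡⟨ cong (c *_) (ball-suc-inner w k≤a) ⟩
    c * ball (w ∘ suc) a k             ∎
    where open ≤-Reasoning
  ... | no  k≰a = begin
    ball (w ∘ suc) a (suc (k ℕ.+ k))        ≡⟨ ball-tail-left w (ℕ.≤-trans a≤k (ℕ.m≤n⇒m≤1+n (ℕ.m≤m+n k k))) ⟩
    window w 1 (suc (a ℕ.+ suc (k ℕ.+ k)))  ≤⟨ window-mono-length w w≥0 1 (a+2k+2≤2[a+k+1] a k) ⟩
    window w 1 (M ℕ.+ M)                    ≤⟨ initial-window-doubling w≥0 (extend-vanishes ν) concave (s≤s z≤n)
                                                 ν-doubling 2≤c (a ℕ.+ k) ⟩
    c * window w 1 M                        ≡⟨ cong (c *_) (ball-tail-left w a≤k) ⟨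
    c * ball (w ∘ suc) a k                  ∎
    where
    open ≤-Reasoning
    a≤k : a ℕ.≤ k
    a≤k = ℕ.<⇒≤ (ℕ.≰⇒> k≰a)
    M : ℕ
    M = suc (a ℕ.+ k)
    concave : Concave (suc n) w
    concave = doubling⇒concave w≥0 c≤3 ν-doubling
    1≤n : 1 ℕ.≤ n
    1≤n = ℕ.≤-trans (s≤s z≤n) a<n
    2≤c : 2ℚ ≤ c
    2≤c = doubling⇒2≤c w≥0 (extend-pos ν>0 (s≤s z≤n)) (extend-pos ν>0 (s≤s 1≤n)) (s≤s 1≤n) ν-doubling

proposition5p2 : (n : ℕ) (ν : Fin (suc n) → ℚ) → IsMeasure ν →
    (c : ℚ) → DoublingBound ν c →
    (ε : ℚ) → 0ℚ < ε →
    Σ (Fin n → ℚ) (λ μ → IsMeasure μ × DoublingBound μ (c + ε))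
proposition5p2 n ν ν>0 c ν-doubling ε ε>0 with c ≤? 3ℚ
... | yes c≤3 = ν ∘ Fin.suc , ν>0 ∘ Fin.suc ,
  fromBallDoubling (ν ∘ Fin.suc) (c + ε)
    (ballDoubling-mono (extend-nonneg (ν>0 ∘ Fin.suc)) (p≤p+q {c} (<⇒≤ ε>0))
      (tail-doubling ν>0 c≤3 (toBallDoubling ν c ν-doubling)))
... | no  c≰3 = uniform n , uniform-isMeasure n ,
  fromBallDoubling (uniform n) (c + ε)
    (ballDoubling-mono (extend-nonneg (uniform-isMeasure n)) (≤-trans (<⇒≤ (≰⇒> c≰3)) (p≤p+q {c} (<⇒≤ ε>0)))
      (uniform-doubling n))
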